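{- Every tame $SL_2(\mathbb{Z}[\sigma])$-tiling $(m_{i,j})_{i,j\in\mathbb{Z}}$ is the scalar product of two bi-infinite normalised paths in $\mathcal{T}$, i.e. there exist normalised paths $(p_i/q_i)_{i\in\mathbb{Z}}$ and $(r_j/s_j)_{j\in\mathbb{Z}}$ with $m_{i,j}=p_ir_j+q_is_j$ for all $i,j$.
   Context: Let $\sigma=e^{i\pi/3}$, $\mathbb{Z}[\sigma]$ the Eisenstein integers, $\widehat{\mathbb{Q}}(\sigma)=\mathbb{Q}(\sigma)\cup\{\infty\}$. A fraction $p/q$ ($p,q\in\mathbb{Z}[\sigma]$, not both zero) is irreducible if every common factor $k\in\mathbb{Z}[\sigma]$ of $p,q$ has $|k|=1$. $\mathcal{T}$ is the graph with vertex set $\widehat{\mathbb{Q}}(\sigma)$ in which points with irreducible representations $p/q$, $r/s$ are adjacent iff $|ps-rq|=1$ (the edges of the tiling of $\mathbb{H}^3$ by images of the regular ideal tetrahedron $0,1,\sigma,\infty$ under its reflection group). A bi-infinite path is a sequence $(v_i)_{i\in\mathbb{Z}}$ of vertices with consecutive ones adjacent; it is normalised if given by irreducible fractions $v_i=p_i/q_i$ with $p_iq_{i+1}-p_{i+1}q_i=1$ for all $i$. A bi-infinite matrix $(m_{i,j})_{i,j\in\mathbb{Z}}$ over $\mathbb{Z}[\sigma]$ is an $SL_2(\mathbb{Z}[\sigma])$-tiling if $m_{i,j}m_{i+1,j+1}-m_{i,j+1}m_{i+1,j}=1$ for all $i,j$, and tame if all $3\times3$ determinants $\det(m_{i+a,j+b})_{a,b=0,1,2}$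 vanish. -}

module Defs where

open import Data.Integer as ℤ using (ℤ; +_; -[1+_])
open import Data.Product using (Σ; _×_; _,_)
open import Relation.Binary.PropositionalEquality using (_≡_)
open import Relation.Nullary using (¬_)

-- Eisenstein integers ℤ[σ], σ = e^{iπ/3}, σ² = σ - 1.
-- The element  re + im·σ  is represented by the pair of integers (re , im).
record ℤσ : Set where
  constructor _+_σ
  field
    re : ℤ
    im : ℤ
open ℤσ public

0σ : ℤσ
0σ = (+ 0) + (+ 0) σ

1σ : ℤσ
1σ = (+ 1) + (+ 0) σ

infixl 6 _⊕_ _⊖_
infixl 7 _⊗_

_⊕_ : ℤσ → ℤσ → ℤσ
(a + b σ) ⊕ (c + d σ) = (a ℤ.+ c) + (b ℤ.+ d) σ

⊝_ : ℤσ → ℤσ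
⊝ (a + b σ) = (ℤ.- a) + (ℤ.- b) σ

_⊖_ : ℤσ → ℤσ → ℤσ
x ⊖ y = x ⊕ (⊝ y)

-- (a + bσ)(c + dσ) = ac + (ad + bc)σ + bd σ² = (ac - bd) + (ad + bc + bd)σ
_⊗_ : ℤσ → ℤσ → ℤσ
(a + b σ) ⊗ (c + d σ) =
  (a ℤ.* c ℤ.- b ℤ.* d) + (a ℤ.* d ℤ.+ b ℤ.* c ℤ.+ b ℤ.* d) σ

-- |a + bσ|² = a² + ab + b²
normσ : ℤσ → ℤ
normσ (a + b σ) = a ℤ.* a ℤ.+ a ℤ.* b ℤ.+ b ℤ.* b

_∣σ_ : ℤσ → ℤσ → Set
k ∣σ x = Σ ℤσ λ c → x ≡ k ⊗ c

Irreducible : ℤσ → ℤσ → Set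
Irreducible p q =
  ¬ (p ≡ 0σ × q ≡ 0σ) × (∀ k → k ∣σ p → k ∣σ q → normσ k ≡ + 1)

NormalisedPath : (ℤ → ℤσ) → (ℤ → ℤσ) → Set
NormalisedPath p q =
  (∀ i → Irreducible (p i) (q i)) ×
  (∀ i → p i ⊗ q (i ℤ.+ + 1) ⊖ p (i ℤ.+ + 1) ⊗ q i ≡ 1σ)

SL2Tiling : (ℤ → ℤ → ℤσ) → Set
SL2Tiling m = ∀ i j →
  m i j ⊗ m (i ℤ.+ + 1) (j ℤ.+ + 1) ⊖ m i (j ℤ.+ + 1) ⊗ m (i ℤ.+ + 1) j ≡ 1σ

det3 : (a b c d e f g h k : ℤσ) → ℤσ
det3 a b c d e f g h k =
  a ⊗ (e ⊗ k ⊖ f ⊗ h) ⊖ b ⊗ (d ⊗ k ⊖ f ⊗ g) ⊕ c ⊗ (d ⊗ h ⊖ e ⊗ g)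

Tame : (ℤ → ℤ → ℤσ) → Set
Tame m = ∀ i j →
  det3 (m i j)          (m i (j ℤ.+ + 1))          (m i (j ℤ.+ + 2))
       (m (i ℤ.+ + 1) j) (m (i ℤ.+ + 1) (j ℤ.+ + 1)) (m (i ℤ.+ + 1) (j ℤ.+ + 2))
       (m (i ℤ.+ + 2) j) (m (i ℤ.+ + 2) (j ℤ.+ + 1)) (m (i ℤ.+ + 2) (j ℤ.+ + 2))
  ≡ 0σ

-- Fix j.  Rows 0 and 1 of the 2×3 block in columns j, j+1, j+2 have unimodular
-- adjacent minors, so by Cramer's rule column j+2 equals β_j · column (j+1) − column j
-- in these two rows.  Expanding a vanishing adjacent 3×3 determinant shows that
-- this three-term recurrence passes from two adjacent rows to the next one (in
-- both directions), hence holds in every row.  As β_j does not depend on the row,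
-- every column is then r_j · column 0 + s_j · column 1, where (r_j, s_j) solves this
-- in rows 0 and 1 via the inverse of the unimodular top-left 2×2 block.  This is
-- m_{ij} = p_i r_j + q_i s_j; both paths inherit determinant 1 from the tiling, and
-- determinant 1 forces irreducibility because a common factor then divides 1.
module Submission where

open import Defs
open import Data.Integer as ℤ using (ℤ; +_; -[1+_]; 0ℤ; +≤+)
import Data.Integer.Properties as ℤP
open import Data.Integer.Solver using (module +-*-Solver)
import Data.Nat as ℕ
import Data.Nat.Properties as ℕP
open import Data.Product using (Σ; _×_; _,_; proj₁; proj₂)
open import Relation.Binary.PropositionalEquality
open import Relation.Binary.Definitions using (DecidableEquality)
open import Relation.Nullary using (yes; no; ¬_)
open import Algebra.Structures {A = ℤσ} _≡_ using (IsCommutativeRing)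
open import Algebra.Bundles using (CommutativeRing)
import Algebra.Solver.Ring.Simple as RingSolver
import Algebra.Solver.Ring.AlmostCommutativeRing as ACR
open ≡-Reasoning

⊕-assoc : ∀ x y z → (x ⊕ y) ⊕ z ≡ x ⊕ (y ⊕ z)
⊕-assoc (a + b σ) (c + d σ) (e + f σ) = cong₂ _+_σ (ℤP.+-assoc a c e) (ℤP.+-assoc b d f)

⊕-comm : ∀ x y → x ⊕ y ≡ y ⊕ x
⊕-comm (a + b σ) (c + d σ) = cong₂ _+_σ (ℤP.+-comm a c) (ℤP.+-comm b d)

⊕-identityˡ : ∀ x → 0σ ⊕ x ≡ x
⊕-identityˡ (a + b σ) = cong₂ _+_σ (ℤP.+-identityˡ a) (ℤP.+-identityˡ b)

⊕-identityʳ : ∀ x → x ⊕ 0σ ≡ x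
⊕-identityʳ (a + b σ) = cong₂ _+_σ (ℤP.+-identityʳ a) (ℤP.+-identityʳ b)

⊝-inverseˡ : ∀ x → ⊝ x ⊕ x ≡ 0σ
⊝-inverseˡ (a + b σ) = cong₂ _+_σ (ℤP.+-inverseˡ a) (ℤP.+-inverseˡ b)

⊝-inverseʳ : ∀ x → x ⊕ ⊝ x ≡ 0σ
⊝-inverseʳ (a + b σ) = cong₂ _+_σ (ℤP.+-inverseʳ a) (ℤP.+-inverseʳ b)

⊗-assoc : ∀ x y z → (x ⊗ y) ⊗ z ≡ x ⊗ (y ⊗ z)
⊗-assoc (a + b σ) (c + d σ) (e + f σ) = cong₂ _+_σ
  (+-*-Solver.solve 6 (λ a b c d e f →
    (a :* c :- b :* d) :* e :- (a :* d :+ b :* c :+ b :* d) :* f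
      := a :* (c :* e :- d :* f) :- b :* (c :* f :+ d :* e :+ d :* f)) refl a b c d e f)
  (+-*-Solver.solve 6 (λ a b c d e f →
    (a :* c :- b :* d) :* f :+ (a :* d :+ b :* c :+ b :* d) :* e :+ (a :* d :+ b :* c :+ b :* d) :* f
      := a :* (c :* f :+ d :* e :+ d :* f) :+ b :* (c :* e :- d :* f) :+ b :* (c :* f :+ d :* e :+ d :* f))
    refl a b c d e f)
  where open +-*-Solver using (_:+_; _:*_; _:-_; _:=_)

⊗-comm : ∀ x y → x ⊗ y ≡ y ⊗ x
⊗-comm (a + b σ) (c + d σ) = cong₂ _+_σ
  (+-*-Solver.solve 4 (λ a b c d → a :* c :- b :* d := c :* a :- d :* b) refl a b c d)
  (+-*-Solver.solve 4 (λ a b c d → a :* d :+ b :* c :+ b :* d := c :* b :+ d :* a :+ d :* b) refl a b c d)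
  where open +-*-Solver using (_:+_; _:*_; _:-_; _:=_)

⊗-identityˡ : ∀ x → 1σ ⊗ x ≡ x
⊗-identityˡ (a + b σ) = cong₂ _+_σ
  (+-*-Solver.solve 2 (λ a b → con (+ 1) :* a :- con (+ 0) :* b := a) refl a b)
  (+-*-Solver.solve 2 (λ a b → con (+ 1) :* b :+ con (+ 0) :* a :+ con (+ 0) :* b := b) refl a b)
  where open +-*-Solver using (_:+_; _:*_; _:-_; _:=_; con)

⊗-identityʳ : ∀ x → x ⊗ 1σ ≡ x
⊗-identityʳ x = trans (⊗-comm x 1σ) (⊗-identityˡ x)

⊗-distribˡ-⊕ : ∀ x y z → x ⊗ (y ⊕ z) ≡ x ⊗ y ⊕ x ⊗ z
⊗-distribˡ-⊕ (a + b σ) (c + d σ) (e + f σ) = cong₂ _+_σ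
  (+-*-Solver.solve 6 (λ a b c d e f →
    a :* (c :+ e) :- b :* (d :+ f) := (a :* c :- b :* d) :+ (a :* e :- b :* f)) refl a b c d e f)
  (+-*-Solver.solve 6 (λ a b c d e f →
    a :* (d :+ f) :+ b :* (c :+ e) :+ b :* (d :+ f)
      := (a :* d :+ b :* c :+ b :* d) :+ (a :* f :+ b :* e :+ b :* f)) refl a b c d e f)
  where open +-*-Solver using (_:+_; _:*_; _:-_; _:=_)

⊗-distribʳ-⊕ : ∀ x y z → (y ⊕ z) ⊗ x ≡ y ⊗ x ⊕ z ⊗ x
⊗-distribʳ-⊕ x y z = begin
  (y ⊕ z) ⊗ x     ≡⟨ ⊗-comm (y ⊕ z) x ⟩
  x ⊗ (y ⊕ z)     ≡⟨ ⊗-distribˡ-⊕ x y z ⟩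
  x ⊗ y ⊕ x ⊗ z   ≡⟨ cong₂ _⊕_ (⊗-comm x y) (⊗-comm x z) ⟩
  y ⊗ x ⊕ z ⊗ x   ∎

⊕-⊗-isCommutativeRing : IsCommutativeRing _⊕_ _⊗_ ⊝_ 0σ 1σ
⊕-⊗-isCommutativeRing = record
  { isRing = record
    { +-isAbelianGroup = record
      { isGroup = record
        { isMonoid = record
          { isSemigroup = record
            { isMagma = record { isEquivalence = isEquivalence ; ∙-cong = cong₂ _⊕_ }
            ; assoc = ⊕-assoc }
          ; identity = ⊕-identityˡ , ⊕-identityʳ }
        ; inverse = ⊝-inverseˡ , ⊝-inverseʳ
        ; ⁻¹-cong = cong ⊝_ }
      ; comm = ⊕-comm }
    ; *-cong = cong₂ _⊗_
    ; *-assoc = ⊗-assoc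
    ; *-identity = ⊗-identityˡ , ⊗-identityʳ
    ; distrib = ⊗-distribˡ-⊕ , ⊗-distribʳ-⊕ }
  ; *-comm = ⊗-comm }

⊕-⊗-commutativeRing : CommutativeRing _ _
⊕-⊗-commutativeRing = record { isCommutativeRing = ⊕-⊗-isCommutativeRing }

_≟σ_ : DecidableEquality ℤσ
(a + b σ) ≟σ (c + d σ) with a ℤ.≟ c | b ℤ.≟ d
... | yes refl | yes refl = yes refl
... | no a≢c   | _        = no λ { refl → a≢c refl }
... | _        | no b≢d   = no λ { refl → b≢d refl }

0σ≢1σ : ¬ (0σ ≡ 1σ)
0σ≢1σ ()

normσ-⊗ : ∀ x y → normσ (x ⊗ y) ≡ normσ x ℤ.* normσ y
normσ-⊗ (a + b σ) (c + d σ) = +-*-Solver.solve 4 (λ a b c d →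
  (a :* c :- b :* d) :* (a :* c :- b :* d) :+ (a :* c :- b :* d) :* (a :* d :+ b :* c :+ b :* d)
    :+ (a :* d :+ b :* c :+ b :* d) :* (a :* d :+ b :* c :+ b :* d)
  := (a :* a :+ a :* b :+ b :* b) :* (c :* c :+ c :* d :+ d :* d)) refl a b c d
  where open +-*-Solver using (_:+_; _:*_; _:-_; _:=_)

4*normσ≡sum-of-squares : ∀ a b →
  + 4 ℤ.* normσ (a + b σ) ≡ (a ℤ.+ a ℤ.+ b) ℤ.* (a ℤ.+ a ℤ.+ b) ℤ.+ + 3 ℤ.* (b ℤ.* b)
4*normσ≡sum-of-squares = +-*-Solver.solve 2 (λ a b →
  con (+ 4) :* (a :* a :+ a :* b :+ b :* b) := (a :+ a :+ b) :* (a :+ a :+ b) :+ con (+ 3) :* (b :* b)) refl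
  where open +-*-Solver using (_:+_; _:*_; _:=_; con)

0≤i*i : ∀ i → 0ℤ ℤ.≤ i ℤ.* i
0≤i*i (+ n)    = ℤP.*-monoʳ-≤-nonNeg (+ n) {0ℤ} {+ n} (+≤+ ℕ.z≤n)
0≤i*i -[1+ n ] = +≤+ ℕ.z≤n

0≤normσ : ∀ x → 0ℤ ℤ.≤ normσ x
0≤normσ (a + b σ) = ℤP.*-cancelˡ-≤-pos 0ℤ (normσ (a + b σ)) (+ 4)
  (subst (0ℤ ℤ.≤_) (sym (4*normσ≡sum-of-squares a b))
    (ℤP.+-mono-≤ (0≤i*i (a ℤ.+ a ℤ.+ b)) (ℤP.*-monoˡ-≤-nonNeg (+ 3) (0≤i*i b))))

normσ-unit : ∀ k u → k ⊗ u ≡ 1σ → normσ k ≡ + 1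
normσ-unit k u k⊗u≡1 = begin
  normσ k            ≡⟨ ℤP.0≤i⇒+∣i∣≡i (0≤normσ k) ⟨
  + ℤ.∣ normσ k ∣    ≡⟨ cong +_ (ℕP.m*n≡1⇒m≡1 _ _ ∣normσk∣*∣normσu∣≡1) ⟩
  + 1                ∎
  where
  ∣normσk∣*∣normσu∣≡1 : ℤ.∣ normσ k ∣ ℕ.* ℤ.∣ normσ u ∣ ≡ 1
  ∣normσk∣*∣normσu∣≡1 = begin
    ℤ.∣ normσ k ∣ ℕ.* ℤ.∣ normσ u ∣   ≡⟨ ℤP.abs-* (normσ k) (normσ u) ⟨
    ℤ.∣ normσ k ℤ.* normσ u ∣         ≡⟨ cong ℤ.∣_∣ (normσ-⊗ k u) ⟨
    ℤ.∣ normσ (k ⊗ u) ∣               ≡⟨ cong (λ x → ℤ.∣ normσ x ∣) k⊗u≡1 ⟩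
    1                                 ∎

module ℤσ-Solver = RingSolver (ACR.fromCommutativeRing ⊕-⊗-commutativeRing) _≟σ_
open ℤσ-Solver using (_:+_; _:*_; _:-_; :-_; _:=_; con)

det2 : ℤσ → ℤσ → ℤσ → ℤσ → ℤσ
det2 a b c d = a ⊗ d ⊖ b ⊗ c

det2-transpose : ∀ a b c d → det2 a b c d ≡ det2 a c b d
det2-transpose a b c d = cong (λ x → a ⊗ d ⊖ x) (⊗-comm b c)

det2-adjugate : ∀ a b c d → det2 d (⊝ b) (⊝ c) a ≡ det2 a b c d
det2-adjugate = ℤσ-Solver.solve 4 (λ a b c d →
  d :* a :- (:- b) :* (:- c) := a :* d :- b :* c) refl

det2-⊗ : ∀ x y z w a b c d →
  det2 (x ⊗ a ⊕ y ⊗ c) (x ⊗ b ⊕ y ⊗ d) (z ⊗ a ⊕ w ⊗ c) (z ⊗ b ⊕ w ⊗ d)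
    ≡ det2 x y z w ⊗ det2 a b c d
det2-⊗ = ℤσ-Solver.solve 8 (λ x y z w a b c d →
  (x :* a :+ y :* c) :* (z :* b :+ w :* d) :- (x :* b :+ y :* d) :* (z :* a :+ w :* c)
    := (x :* w :- y :* z) :* (a :* d :- b :* c)) refl

det2-scale : ∀ k a b c d → det2 (k ⊗ a) b (k ⊗ c) d ≡ k ⊗ det2 a b c d
det2-scale = ℤσ-Solver.solve 5 (λ k a b c d →
  (k :* a) :* d :- b :* (k :* c) := k :* (a :* d :- b :* c)) refl

det2-zero : ∀ b d → det2 0σ b 0σ d ≡ 0σ
det2-zero = ℤσ-Solver.solve 2 (λ b d → con 0σ :* d :- b :* con 0σ := con 0σ) refl

det2≡1⇒irreducible : ∀ a b c d → det2 a b c d ≡ 1σ → Irreducible a c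
det2≡1⇒irreducible a b c d det≡1 = not-both-zero , common-factor-unit
  where
  not-both-zero : ¬ (a ≡ 0σ × c ≡ 0σ)
  not-both-zero (refl , refl) = 0σ≢1σ (trans (sym (det2-zero b d)) det≡1)
  common-factor-unit : ∀ k → k ∣σ a → k ∣σ c → normσ k ≡ + 1
  common-factor-unit k (a′ , refl) (c′ , refl) =
    normσ-unit k (det2 a′ b c′ d) (trans (sym (det2-scale k a′ b c′ d)) det≡1)

ℤσ³ : Set
ℤσ³ = ℤσ × ℤσ × ℤσ

defect : ℤσ → ℤσ³ → ℤσ
defect β (a , b , c) = c ⊕ a ⊖ β ⊗ b

Recurrent : ℤσ → ℤσ³ → Set
Recurrent β u = defect β u ≡ 0σ

minor : ℤσ³ → ℤσ³ → ℤσ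
minor (a , b , _) (a′ , b′ , _) = det2 a b a′ b′

det : ℤσ³ → ℤσ³ → ℤσ³ → ℤσ
det (a , b , c) (d , e , f) (g , h , k) = det3 a b c d e f g h k

lincomb : ℤσ → ℤσ³ → ℤσ → ℤσ³ → ℤσ³
lincomb x (a , b , c) y (a′ , b′ , c′) = x ⊗ a ⊕ y ⊗ a′ , x ⊗ b ⊕ y ⊗ b′ , x ⊗ c ⊕ y ⊗ c′

Recurrent⇒third≡ : ∀ β a b c → Recurrent β (a , b , c) → c ≡ β ⊗ b ⊖ a
Recurrent⇒third≡ β a b c defect≡0 = begin
  c                                    ≡⟨ split ⟩
  defect β (a , b , c) ⊕ (β ⊗ b ⊖ a)   ≡⟨ cong (_⊕ (β ⊗ b ⊖ a)) defect≡0 ⟩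
  0σ ⊕ (β ⊗ b ⊖ a)                     ≡⟨ ⊕-identityˡ (β ⊗ b ⊖ a) ⟩
  β ⊗ b ⊖ a                            ∎
  where
  split : c ≡ defect β (a , b , c) ⊕ (β ⊗ b ⊖ a)
  split = ℤσ-Solver.solve 4 (λ β a b c → c := (c :+ a :- β :* b) :+ (β :* b :- a)) refl β a b c

Recurrent-reverse : ∀ β a b c → Recurrent β (a , b , c) → Recurrent β (c , b , a)
Recurrent-reverse β a b c = trans (cong (_⊖ β ⊗ b) (⊕-comm a c))

Recurrent-third-unique : ∀ β {a b c a′ b′ c′} →
  Recurrent β (a , b , c) → Recurrent β (a′ , b′ , c′) → a ≡ a′ → b ≡ b′ → c ≡ c′
Recurrent-third-unique β {a} {b} {c} {c′ = c′} rec rec′ refl refl =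
  trans (Recurrent⇒third≡ β a b c rec) (sym (Recurrent⇒third≡ β a b c′ rec′))

Recurrent-first-unique : ∀ β {a b c a′ b′ c′} →
  Recurrent β (a , b , c) → Recurrent β (a′ , b′ , c′) → b ≡ b′ → c ≡ c′ → a ≡ a′
Recurrent-first-unique β {a} {b} {c} {a′} {b′} {c′} rec rec′ b≡b′ c≡c′ =
  Recurrent-third-unique β (Recurrent-reverse β a b c rec) (Recurrent-reverse β a′ b′ c′ rec′) c≡c′ b≡b′

Recurrent-lincomb : ∀ β x u y v → Recurrent β u → Recurrent β v → Recurrent β (lincomb x u y v)
Recurrent-lincomb β x u@(a , b , c) y v@(a′ , b′ , c′) rec-u rec-v = begin
  defect β (lincomb x u y v)              ≡⟨ linear ⟩
  x ⊗ defect β u ⊕ y ⊗ defect β v         ≡⟨ cong₂ (λ e e′ → x ⊗ e ⊕ y ⊗ e′) rec-u rec-v ⟩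
  x ⊗ 0σ ⊕ y ⊗ 0σ                         ≡⟨ annihilate ⟩
  0σ                                      ∎
  where
  linear : defect β (lincomb x u y v) ≡ x ⊗ defect β u ⊕ y ⊗ defect β v
  linear = ℤσ-Solver.solve 9 (λ β x y a b c a′ b′ c′ →
    (x :* c :+ y :* c′) :+ (x :* a :+ y :* a′) :- β :* (x :* b :+ y :* b′)
      := x :* (c :+ a :- β :* b) :+ y :* (c′ :+ a′ :- β :* b′)) refl β x y a b c a′ b′ c′
  annihilate : x ⊗ 0σ ⊕ y ⊗ 0σ ≡ 0σ
  annihilate = ℤσ-Solver.solve 2 (λ x y → x :* con 0σ :+ y :* con 0σ := con 0σ) refl x y

Recurrent-of-unimodular : ∀ a₀ b₀ c₀ a₁ b₁ c₁ →
  det2 a₀ b₀ a₁ b₁ ≡ 1σ → det2 b₀ c₀ b₁ c₁ ≡ 1σ →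
  Recurrent (det2 a₀ c₀ a₁ c₁) (a₀ , b₀ , c₀) × Recurrent (det2 a₀ c₀ a₁ c₁) (a₁ , b₁ , c₁)
Recurrent-of-unimodular a₀ b₀ c₀ a₁ b₁ c₁ det-ab≡1 det-bc≡1 =
  from-cramer a₀ b₀ c₀ det-bc≡1 det-ab≡1 cramer₀ , from-cramer a₁ b₁ c₁ det-bc≡1 det-ab≡1 cramer₁
  where
  β : ℤσ
  β = det2 a₀ c₀ a₁ c₁
  cramer₀ : det2 b₀ c₀ b₁ c₁ ⊗ a₀ ⊖ β ⊗ b₀ ⊕ det2 a₀ b₀ a₁ b₁ ⊗ c₀ ≡ 0σ
  cramer₀ = ℤσ-Solver.solve 6 (λ a₀ b₀ c₀ a₁ b₁ c₁ →
    (b₀ :* c₁ :- c₀ :* b₁) :* a₀ :- (a₀ :* c₁ :- c₀ :* a₁) :* b₀ :+ (a₀ :* b₁ :- b₀ :* a₁) :* c₀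
      := con 0σ) refl a₀ b₀ c₀ a₁ b₁ c₁
  cramer₁ : det2 b₀ c₀ b₁ c₁ ⊗ a₁ ⊖ β ⊗ b₁ ⊕ det2 a₀ b₀ a₁ b₁ ⊗ c₁ ≡ 0σ
  cramer₁ = ℤσ-Solver.solve 6 (λ a₀ b₀ c₀ a₁ b₁ c₁ →
    (b₀ :* c₁ :- c₀ :* b₁) :* a₁ :- (a₀ :* c₁ :- c₀ :* a₁) :* b₁ :+ (a₀ :* b₁ :- b₀ :* a₁) :* c₁
      := con 0σ) refl a₀ b₀ c₀ a₁ b₁ c₁
  from-cramer : ∀ a b c {X Y} → X ≡ 1σ → Y ≡ 1σ → X ⊗ a ⊖ β ⊗ b ⊕ Y ⊗ c ≡ 0σ → Recurrent β (a , b , c)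
  from-cramer a b c refl refl = trans (ℤσ-Solver.solve 4 (λ γ a b c →
    c :+ a :- γ :* b := con 1σ :* a :- γ :* b :+ con 1σ :* c) refl β a b c)

-- Add c + a − βb to the third column (which leaves the determinant unchanged)
-- and expand along that column.
det-expansion : ∀ β u v w →
  det u v w ≡ defect β u ⊗ minor v w ⊖ defect β v ⊗ minor u w ⊕ defect β w ⊗ minor u v
det-expansion β (a , b , c) (d , e , f) (g , h , k) = ℤσ-Solver.solve 10 (λ β a b c d e f g h k →
  a :* (e :* k :- f :* h) :- b :* (d :* k :- f :* g) :+ c :* (d :* h :- e :* g)
    := (c :+ a :- β :* b) :* (d :* h :- e :* g) :- (f :+ d :- β :* e) :* (a :* h :- b :* g)
       :+ (k :+ g :- β :* h) :* (a :* e :- b :* d)) refl β a b c d e f g h k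

Recurrent-third-row : ∀ β u v w → Recurrent β u → Recurrent β v →
  minor u v ≡ 1σ → det u v w ≡ 0σ → Recurrent β w
Recurrent-third-row β u v w rec-u rec-v minor≡1 det≡0 = begin
  defect β w
    ≡⟨ only-last (minor v w) (minor u w) (defect β w) ⟨
  0σ ⊗ minor v w ⊖ 0σ ⊗ minor u w ⊕ defect β w ⊗ 1σ
    ≡⟨ cong₂ (λ e₁ e₂ → e₁ ⊗ minor v w ⊖ e₂ ⊗ minor u w ⊕ defect β w ⊗ 1σ) rec-u rec-v ⟨
  defect β u ⊗ minor v w ⊖ defect β v ⊗ minor u w ⊕ defect β w ⊗ 1σ
    ≡⟨ cong (λ μ → defect β u ⊗ minor v w ⊖ defect β v ⊗ minor u w ⊕ defect β w ⊗ μ) minor≡1 ⟨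
  defect β u ⊗ minor v w ⊖ defect β v ⊗ minor u w ⊕ defect β w ⊗ minor u v
    ≡⟨ det-expansion β u v w ⟨
  det u v w
    ≡⟨ det≡0 ⟩
  0σ ∎
  where
  only-last : ∀ x y z → 0σ ⊗ x ⊖ 0σ ⊗ y ⊕ z ⊗ 1σ ≡ z
  only-last = ℤσ-Solver.solve 3 (λ x y z → con 0σ :* x :- con 0σ :* y :+ z :* con 1σ := z) refl

Recurrent-first-row : ∀ β u v w → Recurrent β v → Recurrent β w →
  minor v w ≡ 1σ → det u v w ≡ 0σ → Recurrent β u
Recurrent-first-row β u v w rec-v rec-w minor≡1 det≡0 = begin
  defect β u
    ≡⟨ only-first (defect β u) (minor u w) (minor u v) ⟨
  defect β u ⊗ 1σ ⊖ 0σ ⊗ minor u w ⊕ 0σ ⊗ minor u v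
    ≡⟨ cong₂ (λ e₂ e₃ → defect β u ⊗ 1σ ⊖ e₂ ⊗ minor u w ⊕ e₃ ⊗ minor u v) rec-v rec-w ⟨
  defect β u ⊗ 1σ ⊖ defect β v ⊗ minor u w ⊕ defect β w ⊗ minor u v
    ≡⟨ cong (λ μ → defect β u ⊗ μ ⊖ defect β v ⊗ minor u w ⊕ defect β w ⊗ minor u v) minor≡1 ⟨
  defect β u ⊗ minor v w ⊖ defect β v ⊗ minor u w ⊕ defect β w ⊗ minor u v
    ≡⟨ det-expansion β u v w ⟨
  det u v w
    ≡⟨ det≡0 ⟩
  0σ ∎
  where
  only-first : ∀ x y z → x ⊗ 1σ ⊖ 0σ ⊗ y ⊕ 0σ ⊗ z ≡ x
  only-first = ℤσ-Solver.solve 3 (λ x y z → x :* con 1σ :- con 0σ :* y :+ con 0σ :* z := x) refl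

ℤ-induction : (P : ℤ → Set) → P (+ 0) →
  (∀ i → P i → P (i ℤ.+ + 1)) → (∀ i → P (i ℤ.+ + 1) → P i) → ∀ i → P i
ℤ-induction P P₀ up down (+ n) = nonNegative n
  where
  nonNegative : ∀ n → P (+ n)
  nonNegative ℕ.zero    = P₀
  nonNegative (ℕ.suc n) = subst P (cong +_ (ℕP.+-comm n 1)) (up (+ n) (nonNegative n))
ℤ-induction P P₀ up down -[1+ n ] = negative n
  where
  negative : ∀ n → P -[1+ n ]
  negative ℕ.zero    = down -[1+ 0 ] P₀
  negative (ℕ.suc n) = down -[1+ ℕ.suc n ] (negative n)

i+1+1≡i+2 : ∀ i → i ℤ.+ + 1 ℤ.+ + 1 ≡ i ℤ.+ + 2
i+1+1≡i+2 i = ℤP.+-assoc i (+ 1) (+ 1)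

ℤ-induction₂ : (P : ℤ → Set) → P (+ 0) → P (+ 1) →
  (∀ i → P i → P (i ℤ.+ + 1) → P (i ℤ.+ + 2)) →
  (∀ i → P (i ℤ.+ + 1) → P (i ℤ.+ + 2) → P i) → ∀ i → P i
ℤ-induction₂ P P₀ P₁ up down i = proj₁ (ℤ-induction (λ i → P i × P (i ℤ.+ + 1)) (P₀ , P₁) up₂ down₂ i)
  where
  up₂ : ∀ i → P i × P (i ℤ.+ + 1) → P (i ℤ.+ + 1) × P (i ℤ.+ + 1 ℤ.+ + 1)
  up₂ i (Pᵢ , Pᵢ₊₁) = Pᵢ₊₁ , subst P (sym (i+1+1≡i+2 i)) (up i Pᵢ Pᵢ₊₁)
  down₂ : ∀ i → P (i ℤ.+ + 1) × P (i ℤ.+ + 1 ℤ.+ + 1) → P i × P (i ℤ.+ + 1)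
  down₂ i (Pᵢ₊₁ , Pᵢ₊₂) = down i Pᵢ₊₁ (subst P (i+1+1≡i+2 i) Pᵢ₊₂) , Pᵢ₊₁

normalisedPath : ∀ p q → (∀ i → det2 (p i) (p (i ℤ.+ + 1)) (q i) (q (i ℤ.+ + 1)) ≡ 1σ) →
  NormalisedPath p q
normalisedPath p q unimodular =
  (λ i → det2≡1⇒irreducible (p i) (p (i ℤ.+ + 1)) (q i) (q (i ℤ.+ + 1)) (unimodular i)) , unimodular

module TameTilingFactorisation (m : ℤ → ℤ → ℤσ) (unimodular : SL2Tiling m) (tame : Tame m) where
  open import Data.Integer using (_+_)

  triple : (ℤ → ℤσ) → ℤ → ℤσ³
  triple f j = f j , f (j + + 1) , f (j + + 2)

  row : ℤ → ℤ → ℤσ³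
  row i = triple (m i)

  unimodular-below : ∀ i j → minor (row (i + + 1) j) (row (i + + 2) j) ≡ 1σ
  unimodular-below i j =
    subst (λ k → det2 (m (i + + 1) j) (m (i + + 1) (j + + 1)) (m k j) (m k (j + + 1)) ≡ 1σ)
      (i+1+1≡i+2 i) (unimodular (i + + 1) j)

  unimodular-right : ∀ i j →
    det2 (m i (j + + 1)) (m i (j + + 2)) (m (i + + 1) (j + + 1)) (m (i + + 1) (j + + 2)) ≡ 1σ
  unimodular-right i j =
    subst (λ k → det2 (m i (j + + 1)) (m i k) (m (i + + 1) (j + + 1)) (m (i + + 1) k) ≡ 1σ)
      (i+1+1≡i+2 j) (unimodular i (j + + 1))

  β : ℤ → ℤσ
  β j = det2 (m (+ 0) j) (m (+ 0) (j + + 2)) (m (+ 1) j) (m (+ 1) (j + + 2))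

  rows-recurrent : ∀ j i → Recurrent (β j) (row i j)
  rows-recurrent j = ℤ-induction₂ (λ i → Recurrent (β j) (row i j))
    (proj₁ top-rows) (proj₂ top-rows)
    (λ i recᵢ recᵢ₊₁ → Recurrent-third-row (β j) (row i j) (row (i + + 1) j) (row (i + + 2) j)
      recᵢ recᵢ₊₁ (unimodular i j) (tame i j))
    (λ i recᵢ₊₁ recᵢ₊₂ → Recurrent-first-row (β j) (row i j) (row (i + + 1) j) (row (i + + 2) j)
      recᵢ₊₁ recᵢ₊₂ (unimodular-below i j) (tame i j))
    where
    top-rows : Recurrent (β j) (row (+ 0) j) × Recurrent (β j) (row (+ 1) j)
    top-rows = Recurrent-of-unimodular
      (m (+ 0) j) (m (+ 0) (j + + 1)) (m (+ 0) (j + + 2))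
      (m (+ 1) j) (m (+ 1) (j + + 1)) (m (+ 1) (j + + 2))
      (unimodular (+ 0) j) (unimodular-right (+ 0) j)

  m₀₀ m₀₁ m₁₀ m₁₁ : ℤσ
  m₀₀ = m (+ 0) (+ 0)
  m₀₁ = m (+ 0) (+ 1)
  m₁₀ = m (+ 1) (+ 0)
  m₁₁ = m (+ 1) (+ 1)

  p q r s : ℤ → ℤσ
  p i = m i (+ 0)
  q i = m i (+ 1)
  -- (r j , s j) is the top of column j multiplied by the inverse of the top-left
  -- 2×2 block, which is its adjugate since the block has determinant 1.
  r j = m₁₁ ⊗ m (+ 0) j ⊕ ⊝ m₀₁ ⊗ m (+ 1) j
  s j = ⊝ m₁₀ ⊗ m (+ 0) j ⊕ m₀₀ ⊗ m (+ 1) j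

  products-recurrent : ∀ i j → Recurrent (β j) (lincomb (p i) (triple r j) (q i) (triple s j))
  products-recurrent i j =
    Recurrent-lincomb (β j) (p i) (triple r j) (q i) (triple s j)
      (top-combination-recurrent m₁₁ (⊝ m₀₁)) (top-combination-recurrent (⊝ m₁₀) m₀₀)
    where
    top-combination-recurrent : ∀ x y → Recurrent (β j) (lincomb x (row (+ 0) j) y (row (+ 1) j))
    top-combination-recurrent x y = Recurrent-lincomb (β j) x (row (+ 0) j) y (row (+ 1) j)
      (rows-recurrent j (+ 0)) (rows-recurrent j (+ 1))

  Factorised : ℤ → Set
  Factorised j = ∀ i → m i j ≡ p i ⊗ r j ⊕ q i ⊗ s j

  factorised-0 : Factorised (+ 0)
  factorised-0 i = sym (begin
    p i ⊗ r (+ 0) ⊕ q i ⊗ s (+ 0)   ≡⟨ adjugate-column₀ (p i) (q i) m₀₀ m₀₁ m₁₀ m₁₁ ⟩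
    p i ⊗ det2 m₀₀ m₀₁ m₁₀ m₁₁        ≡⟨ cong (p i ⊗_) (unimodular (+ 0) (+ 0)) ⟩
    p i ⊗ 1σ                         ≡⟨ ⊗-identityʳ (p i) ⟩
    p i                              ∎)
    where
    adjugate-column₀ : ∀ x y a b c d →
      x ⊗ (d ⊗ a ⊕ ⊝ b ⊗ c) ⊕ y ⊗ (⊝ c ⊗ a ⊕ a ⊗ c) ≡ x ⊗ det2 a b c d
    adjugate-column₀ = ℤσ-Solver.solve 6 (λ x y a b c d →
      x :* (d :* a :+ (:- b) :* c) :+ y :* ((:- c) :* a :+ a :* c) := x :* (a :* d :- b :* c)) refl

  factorised-1 : Factorised (+ 1)
  factorised-1 i = sym (begin
    p i ⊗ r (+ 1) ⊕ q i ⊗ s (+ 1)   ≡⟨ adjugate-column₁ (p i) (q i) m₀₀ m₀₁ m₁₀ m₁₁ ⟩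
    q i ⊗ det2 m₀₀ m₀₁ m₁₀ m₁₁        ≡⟨ cong (q i ⊗_) (unimodular (+ 0) (+ 0)) ⟩
    q i ⊗ 1σ                         ≡⟨ ⊗-identityʳ (q i) ⟩
    q i                              ∎)
    where
    adjugate-column₁ : ∀ x y a b c d →
      x ⊗ (d ⊗ b ⊕ ⊝ b ⊗ d) ⊕ y ⊗ (⊝ c ⊗ b ⊕ a ⊗ d) ≡ y ⊗ det2 a b c d
    adjugate-column₁ = ℤσ-Solver.solve 6 (λ x y a b c d →
      x :* (d :* b :+ (:- b) :* d) :+ y :* ((:- c) :* b :+ a :* d) := y :* (a :* d :- b :* c)) refl

  factorised : ∀ j → Factorised j
  factorised = ℤ-induction₂ Factorised factorised-0 factorised-1
    (λ j Fⱼ Fⱼ₊₁ i → Recurrent-third-unique (β j)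
      (rows-recurrent j i) (products-recurrent i j) (Fⱼ i) (Fⱼ₊₁ i))
    (λ j Fⱼ₊₁ Fⱼ₊₂ i → Recurrent-first-unique (β j)
      (rows-recurrent j i) (products-recurrent i j) (Fⱼ₊₁ i) (Fⱼ₊₂ i))

  pq-unimodular : ∀ i → det2 (p i) (p (i + + 1)) (q i) (q (i + + 1)) ≡ 1σ
  pq-unimodular i = trans (det2-transpose (p i) (p (i + + 1)) (q i) (q (i + + 1))) (unimodular i (+ 0))

  rs-unimodular : ∀ j → det2 (r j) (r (j + + 1)) (s j) (s (j + + 1)) ≡ 1σ
  rs-unimodular j = begin
    det2 (r j) (r (j + + 1)) (s j) (s (j + + 1))
      ≡⟨ det2-⊗ m₁₁ (⊝ m₀₁) (⊝ m₁₀) m₀₀ (m (+ 0) j) (m (+ 0) (j + + 1)) (m (+ 1) j) (m (+ 1) (j + + 1)) ⟩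
    det2 m₁₁ (⊝ m₀₁) (⊝ m₁₀) m₀₀ ⊗ det2 (m (+ 0) j) (m (+ 0) (j + + 1)) (m (+ 1) j) (m (+ 1) (j + + 1))
      ≡⟨ cong₂ _⊗_ (trans (det2-adjugate m₀₀ m₀₁ m₁₀ m₁₁) (unimodular (+ 0) (+ 0))) (unimodular (+ 0) j) ⟩
    1σ ⊗ 1σ
      ≡⟨ ⊗-identityˡ 1σ ⟩
    1σ ∎

proposition5p11 : (m : ℤ → ℤ → ℤσ) → SL2Tiling m → Tame m →
    Σ (ℤ → ℤσ) λ p → Σ (ℤ → ℤσ) λ q → Σ (ℤ → ℤσ) λ r → Σ (ℤ → ℤσ) λ s →
      NormalisedPath p q × NormalisedPath r s ×
      (∀ i j → m i j ≡ p i ⊗ r j ⊕ q i ⊗ s j)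
proposition5p11 m unimodular tame =
  p , q , r , s ,
  normalisedPath p q pq-unimodular ,
  normalisedPath r s rs-unimodular ,
  λ i j → factorised j i
  where open TameTilingFactorisation m unimodular tame
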